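{- Let $p,\ell\in\mathbb{N}$ and let $H=(L,R,E)$ be a bipartite graph with ladder index smaller than $\ell$. Then the Ladder Algorithm applied to $H$ with parameter $p$ terminates after performing fewer than $R^p(2\ell)$ full rounds (regardless of which choices are made in its steps).
   Context: A bipartite graph is $H=(L,R,E)$ with $E\subseteq L\times R$; sequences $a_1,\dots,a_n\in L$, $b_1,\dots,b_n\in R$ form a ladder of order $n$ if $(a_i,b_j)\in E\iff i>j$ for all $i,j$, and the ladder index is the maximum order of a ladder. The Ladder Algorithm with parameter $p$ maintains sets $A\subseteq L$ and $B\subseteq R$, initially empty, and proceeds in rounds, each consisting of two steps. Candidate step: if there is $a\in L$ adjacent to every element of $B$, choose any such $a$, add it to $A$ and go to the witness step; otherwise terminate. Witness step: if there is a set $P\subseteq R$ with $|P|\le p$ such that every element of $A$ is non-adjacent to some element of $P$, choose any such $P$, add its elements to $B$ and proceed to the next round; otherwise terminate. A full round is one completing both steps and proceeding to the next round. $R^c(m)$ is the multicolor Ramsey number: the least $N$ such that every $c$-coloring of the edges of $K_N$ contains a monochromatic set of $m$ vertices. -}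

module Defs where

open import Data.Nat using (ℕ; _<_; _≤_)
open import Data.Fin using (Fin)
open import Data.List using (List; length)
open import Data.List.Membership.Propositional using (_∈_)
open import Data.Product using (Σ; ∃; _×_; _,_)
open import Relation.Nullary using (¬_)
open import Relation.Binary.PropositionalEquality using (_≡_; _≢_)
open import Function.Bundles using (_⇔_)
open import Function.Definitions using (Injective)

-- Bipartite graphs H = (L, R, E) are given by two types L, R and an
-- edge relation E : L → R → Set  ((a , b) ∈ E  iff  E a b).

IsLadder : {L R : Set} (E : L → R → Set) (n : ℕ) →
           (Fin n → L) → (Fin n → R) → Set
IsLadder E n a b = ∀ (i j : Fin n) → (E (a i) (b j) ⇔ (j Data.Fin.< i))

LadderIndexBelow : {L R : Set} (E : L → R → Set) (ℓ : ℕ) → Set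
LadderIndexBelow E ℓ =
  ∀ (n : ℕ) (a : Fin n → _) (b : Fin n → _) → IsLadder E n a b → n < ℓ

-- A run of the Ladder Algorithm with parameter p performing k full
-- rounds.  In round r (r = 0,…,k-1) the candidate step chooses a r ∈ L
-- and the witness step chooses the set P r ⊆ R, given as a list of
-- length ≤ p.  Before round r:  B = ⋃_{s<r} P s ; after the candidate
-- step of round r:  A = { a s | s ≤ r }.

record FullRounds {L R : Set} (E : L → R → Set) (p k : ℕ) : Set where
  field
    cand : Fin k → L
    wit  : Fin k → List R
    wit-size  : ∀ r → length (wit r) ≤ p
    cand-ok   : ∀ r s → s Data.Fin.< r → ∀ y → y ∈ wit s → E (cand r) y
    wit-ok    : ∀ r s → s Data.Fin.≤ r → ∃ λ y → y ∈ wit r × ¬ E (cand s) y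

-- A c-colouring of the edges of K_N is a
-- symmetric map χ : Fin N → Fin N → Fin c (values on the diagonal are
-- irrelevant).

Colouring : (c N : ℕ) → Set
Colouring c N = Σ (Fin N → Fin N → Fin c) λ χ → ∀ i j → χ i j ≡ χ j i

HasMonochromatic : {c N : ℕ} → Colouring c N → (m : ℕ) → Set
HasMonochromatic {c} {N} (χ , _) m =
  Σ (Fin m → Fin N) λ f → Injective _≡_ _≡_ f ×
    ∃ λ (k : Fin c) → ∀ i j → i ≢ j → χ (f i) (f j) ≡ k

RamseyProperty : (c m N : ℕ) → Set
RamseyProperty c m N = ∀ (χ : Colouring c N) → HasMonochromatic χ m

IsRamseyNumber : (c m N : ℕ) → Set
IsRamseyNumber c m N =
  RamseyProperty c m N × (∀ N′ → RamseyProperty c m N′ → N ≤ N′)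

module Submission where

-- Suppose a run performs k ≥ N = R^p(2ℓ) full rounds.
-- For rounds s < r the witness set P_r contains an element that is not
-- adjacent to the candidate a_s; colour the pair {s, r} by the POSITION
-- of such an element in the list P_r, a colour in Fin p.  By the Ramsey
-- property (which passes from N to every k ≥ N) some 2ℓ rounds
-- t₀ < t₁ < … < t_{2ℓ-1} receive a single colour c on all their pairs.
-- Let a_i be the candidate of round t_{2i} and b_j the element at
-- position c of the witness set of round t_{2j+1}.  If j < i then b_j was
-- already in B when a_i was chosen, so a_i and b_j are adjacent; if
-- i ≤ j then the pair {t_{2i}, t_{2j+1}} has colour c, so b_j is the
-- witness against a_i.  Hence (a, b) is a ladder of order ℓ, contradicting
-- the ladder index bound.

open import Defs
open import Data.Nat using (ℕ; _<_; _*_)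
open import Data.Nat as ℕ using (suc; _≤_)
import Data.Nat.Properties as ℕP
open import Data.Fin as F using (Fin; inject≤; punchIn; cast; combine)
import Data.Fin.Properties as FP
open import Data.List using (length; lookup; allFin)
open import Data.List.Membership.Propositional.Properties using (∈-lookup; ∈-allFin)
import Data.List.Relation.Unary.All as All
open import Data.List.Relation.Unary.Any using (index)
open import Data.List.Relation.Unary.Any.Properties using (lookup-index)
import Data.List.Extrema
open import Data.Product using (Σ; ∃; ∃₂; _×_; _,_; proj₁; proj₂)
open import Data.Empty using (⊥-elim)
open import Function.Base using (_∘_)
open import Function.Bundles using (mk⇔)
open import Function.Definitions using (Injective)
open import Relation.Nullary using (¬_; yes; no)
open import Relation.Binary.PropositionalEquality
  using (_≡_; refl; sym; trans; cong; subst; subst₂)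

StrictlyIncreasing : {m n : ℕ} → (Fin m → Fin n) → Set
StrictlyIncreasing g = ∀ {x y} → x F.< y → g x F.< g y

minimumAt : ∀ {m N} (f : Fin (suc m) → Fin N) → ∃ λ i → ∀ j → f i F.≤ f j
minimumAt {m} {N} f =
  i₀ , λ j → All.lookup (f[argmin]≤f[xs] {f = f} F.zero (allFin (suc m))) (∈-allFin j)
  where
  open Data.List.Extrema (FP.≤-totalOrder N)
  i₀ = argmin f F.zero (allFin (suc m))

-- Selection sort: the values of an injective map can be enumerated in
-- increasing order.  The minimum comes first, the rest is sorted
-- recursively after removing it with punchIn.
sortInjective : ∀ {m N} (f : Fin m → Fin N) → Injective _≡_ _≡_ f →
                ∃ λ (h : Fin m → Fin m) → StrictlyIncreasing (f ∘ h)
sortInjective {ℕ.zero} f _ = (λ ()) , λ { {()} }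
sortInjective {suc m} f f-inj with minimumAt f
... | i₀ , minimal
    with sortInjective (f ∘ punchIn i₀)
           (λ {x} {y} e → FP.punchIn-injective i₀ x y (f-inj e))
... | h′ , h′-incr = h , incr
  where
  h : Fin (suc m) → Fin (suc m)
  h F.zero    = i₀
  h (F.suc x) = punchIn i₀ (h′ x)

  incr : StrictlyIncreasing (f ∘ h)
  incr {F.zero} {F.suc y} _ =
    FP.≤∧≢⇒< (minimal _) (λ e → FP.punchInᵢ≢i i₀ (h′ y) (sym (f-inj e)))
  incr {F.suc x} {F.suc y} (ℕ.s≤s x<y) = h′-incr x<y

increasingMonochromatic :
  ∀ {c N m} (χ : Colouring c N) → HasMonochromatic χ m →
  ∃₂ λ (t : Fin m → Fin N) (colour : Fin c) → StrictlyIncreasing t ×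
     (∀ {x y} → x F.< y → proj₁ χ (t x) (t y) ≡ colour)
increasingMonochromatic χ (f , f-inj , colour , mono) with sortInjective f f-inj
... | h , incr =
  f ∘ h , colour , incr ,
  λ x<y → mono (h _) (h _) (λ e → FP.<⇒≢ (incr x<y) (cong f e))

-- The Ramsey property is upward closed in the number of vertices: a
-- colouring of a larger complete graph restricts to the first N vertices.
ramsey-upward : ∀ {c m N N′} → N ≤ N′ →
                RamseyProperty c m N → RamseyProperty c m N′
ramsey-upward {c} {m} {N} {N′} N≤N′ ramsey (χ′ , χ′-sym) =
  let f , f-inj , colour , mono = ramsey restricted
  in  embed ∘ f , (λ e → f-inj (FP.inject≤-injective N≤N′ N≤N′ _ _ e)) , colour , mono
  where
  embed : Fin N → Fin N′
  embed i = inject≤ i N≤N′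

  restricted : Colouring c N
  restricted = (λ i j → χ′ (embed i) (embed j)) , λ i j → χ′-sym (embed i) (embed j)

symmetrise : ∀ {n} {A : Set} → (Fin n → Fin n → A) → Fin n → Fin n → A
symmetrise C i j with i F.≤? j
... | yes _ = C i j
... | no  _ = C j i

symmetrise-sym : ∀ {n} {A : Set} (C : Fin n → Fin n → A) i j →
                 symmetrise C i j ≡ symmetrise C j i
symmetrise-sym C i j with i F.≤? j | j F.≤? i
... | yes i≤j | yes j≤i with FP.≤-antisym i≤j j≤i
...   | refl = refl
symmetrise-sym C i j | yes _ | no _ = refl
symmetrise-sym C i j | no _ | yes _ = refl
symmetrise-sym C i j | no i≰j | no j≰i = ⊥-elim (i≰j (ℕP.<⇒≤ (ℕP.≰⇒> j≰i)))

symmetrise-< : ∀ {n} {A : Set} (C : Fin n → Fin n → A) {i j} → i F.< j →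
               symmetrise C i j ≡ C i j
symmetrise-< C {i} {j} i<j with i F.≤? j
... | yes _   = refl
... | no i≰j = ⊥-elim (i≰j (ℕP.<⇒≤ i<j))

-- Interleaving: position 2i ("even i") and 2j + 1 ("odd j") of Fin (2 * ℓ).
-- Even i precedes odd j exactly when i ≤ j.
module Interleaving (ℓ : ℕ) where

  cast-mono-< : ∀ {x y : Fin (ℓ * 2)} → x F.< y →
                cast (ℕP.*-comm ℓ 2) x F.< cast (ℕP.*-comm ℓ 2) y
  cast-mono-< {x} {y} =
    subst₂ ℕ._<_ (sym (FP.toℕ-cast _ x)) (sym (FP.toℕ-cast _ y))

  even odd : Fin ℓ → Fin (2 * ℓ)
  even i = cast (ℕP.*-comm ℓ 2) (combine i F.zero)
  odd  j = cast (ℕP.*-comm ℓ 2) (combine j (F.suc F.zero))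

  even<odd : ∀ {i j} → i F.≤ j → even i F.< odd j
  even<odd {i} {j} i≤j = cast-mono-<
    (subst₂ ℕ._<_ (sym (FP.toℕ-combine i F.zero)) (sym (FP.toℕ-combine j (F.suc F.zero)))
      (ℕP.+-mono-≤-< (ℕP.*-monoʳ-≤ 2 i≤j) (ℕ.s≤s ℕ.z≤n)))

  odd<even : ∀ {i j} → j F.< i → odd j F.< even i
  odd<even j<i = cast-mono-< (FP.combine-monoˡ-< (F.suc F.zero) F.zero j<i)

module Rounds {L R : Set} {E : L → R → Set} {p k : ℕ} (run : FullRounds E p k) where
  open FullRounds run

  -- For s ≤ r, a position in the witness set of round r holding an element
  -- not adjacent to the candidate of round s.  (For s > r any position is
  -- returned; the witness set of round r is nonempty.)
  witnessIndex : (s r : Fin k) →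
                 Σ (Fin (length (wit r))) λ x → s F.≤ r → ¬ E (cand s) (lookup (wit r) x)
  witnessIndex s r with s F.≤? r
  ... | yes s≤r with wit-ok r s s≤r
  ...   | y , y∈P , ¬Esy =
          index y∈P , λ _ e → ¬Esy (subst (E (cand s)) (sym (lookup-index y∈P)) e)
  witnessIndex s r | no s≰r with wit-ok r r FP.≤-refl
  ...   | _ , y∈P , _ = index y∈P , λ s≤r → ⊥-elim (s≰r s≤r)

  roundColour : Fin k → Fin k → Fin p
  roundColour s r = inject≤ (proj₁ (witnessIndex s r)) (wit-size r)

  roundColour-injective : ∀ s s′ r → roundColour s r ≡ roundColour s′ r →
                          proj₁ (witnessIndex s r) ≡ proj₁ (witnessIndex s′ r)
  roundColour-injective s s′ r =
    FP.inject≤-injective (wit-size r) (wit-size r) _ _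

  roundColouring : Colouring p k
  roundColouring = symmetrise roundColour , symmetrise-sym roundColour

  ladder : ∀ ℓ (t : Fin (2 * ℓ) → Fin k) (colour : Fin p) → StrictlyIncreasing t →
           (∀ {x y} → x F.< y → symmetrise roundColour (t x) (t y) ≡ colour) →
           ∃₂ λ a b → IsLadder E ℓ a b
  ladder ℓ t colour incr mono = a , b , λ i j → mk⇔ (adjacent⇒below i j) (below⇒adjacent i j)
    where
    open Interleaving ℓ

    witnessAgainst : Fin ℓ → (j : Fin ℓ) → Fin (length (wit (t (odd j))))
    witnessAgainst i j = proj₁ (witnessIndex (t (even i)) (t (odd j)))

    a : Fin ℓ → L
    a i = cand (t (even i))
    b : Fin ℓ → R
    b j = lookup (wit (t (odd j))) (witnessAgainst j j)

    -- For i ≤ j the pair (even i, odd j) has colour `colour`, hence b j is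
    -- also the witness against a i.
    sameWitness : ∀ {i j} → i F.≤ j → witnessAgainst i j ≡ witnessAgainst j j
    sameWitness {i} {j} i≤j = roundColour-injective (t (even i)) (t (even j)) (t (odd j))
      (trans (colourOf i≤j) (sym (colourOf (FP.≤-refl {x = j}))))
      where
      colourOf : ∀ {i′} → i′ F.≤ j → roundColour (t (even i′)) (t (odd j)) ≡ colour
      colourOf i′≤j = trans (sym (symmetrise-< roundColour (incr (even<odd i′≤j))))
                            (mono (even<odd i′≤j))

    below⇒adjacent : ∀ i j → j F.< i → E (a i) (b j)
    below⇒adjacent i j j<i =
      cand-ok (t (even i)) (t (odd j)) (incr (odd<even j<i)) _ (∈-lookup _)

    adjacent⇒below : ∀ i j → E (a i) (b j) → j F.< i
    adjacent⇒below i j e with j F.<? i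
    ... | yes j<i = j<i
    ... | no j≮i = ⊥-elim
      (proj₂ (witnessIndex (t (even i)) (t (odd j))) (ℕP.<⇒≤ (incr (even<odd i≤j)))
             (subst (E (a i) ∘ lookup (wit (t (odd j)))) (sym (sameWitness i≤j)) e))
      where
      i≤j : i F.≤ j
      i≤j = ℕP.≮⇒≥ j≮i

longRunHasLadder : ∀ p ℓ {L R : Set} {E : L → R → Set} {k} →
                   RamseyProperty p (2 * ℓ) k → FullRounds E p k →
                   ∃₂ λ a b → IsLadder E ℓ a b
longRunHasLadder p ℓ ramsey run =
  let t , colour , incr , mono =
        increasingMonochromatic roundColouring (ramsey roundColouring)
  in  ladder ℓ t colour incr mono
  where open Rounds run

lemma15 : (p ℓ : ℕ) {L R : Set} (E : L → R → Set) →
          LadderIndexBelow E ℓ →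
          (N : ℕ) → IsRamseyNumber p (2 * ℓ) N →
          (k : ℕ) → FullRounds E p k → k < N
lemma15 p ℓ E ladderIndex N (ramsey , _) k run with N ℕ.≤? k
... | no N≰k = ℕP.≰⇒> N≰k
... | yes N≤k with longRunHasLadder p ℓ (ramsey-upward N≤k ramsey) run
...   | a , b , isLadder = ⊥-elim (ℕP.<-irrefl refl (ladderIndex ℓ a b isLadder))
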